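{- Let $V$ be a finite set of $n\ge2$ vertices with $n$ even, $\ell\ge0$ an integer, and $w:V^2\to\mathbb{N}$ an $\ell$-bounded symmetric weight function, with associated graph $G=(V,E)$, $E=\{uv: w(u,v)>0\}$. For $X\subseteq V$ and $f:X\to\{1,\dots,\ell+1\}$ let $\overline{X}=V\setminus X$ and define $\overline{f}:\overline{X}\to\{1,\dots,\ell+1\}$ by \[\overline{f}(v)=1+\max\bigl(\{1+w(u,v)-f(u): uv\in E,\ u\in X\}\cup\{0\}\bigr).\] Then the span of $w$ equals \[\min\bigl(T[X,f]+T[\overline{X},\overline{f}]-1\bigr),\] where the minimum is over all pairs $(X,f)$ with $X\subseteq V$, $|X|=n/2$, and $f:X\to\{1,\dots,\ell+1\}$.
   Context: $\mathbb{N}=\{0,1,2,\dots\}$; $w$ is $\ell$-bounded if $w(x,y)\le\ell$ for all $x,y$. An assignment $c:V\to\{1,\dots,s\}$ is proper if $|c(x)-c(y)|\ge w(x,y)$ for all distinct $x,y\in V$; the span of $w$ is the minimum $s$ for which a proper assignment $V\to\{1,\dots,s\}$ exists. For $Y\subseteq V$ and $g:Y\to\{1,\dots,\ell+1\}$, $\mathcal{A}_{Y,g}$ is the set of assignments $c:Y\to\mathbb{N}$ with $|c(x)-c(y)|\ge w(x,y)$ for all distinct $x,y\in Y$ and $c(y)\ge g(y)$ for all $y\in Y$; the span of such $c$ is $\max_{y\in Y}c(y)$, and $T[Y,g]$ is the minimum span of an assignment in $\mathcal{A}_{Y,g}$. -}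

module Defs where

open import Data.Nat using (ℕ; zero; suc; _+_; _∸_; _≤_; _<_; _⊔_)
open import Data.Fin using (Fin)
import Data.Fin as F
open import Data.Bool using (Bool; true; false; if_then_else_; _∧_)
open import Data.Vec using (lookup)
open import Data.Fin.Subset using (Subset; ∁)
open import Data.Product using (Σ; ∃; _×_)
open import Relation.Nullary using (¬_; Dec; yes; no)
open import Relation.Nullary.Decidable using (⌊_⌋)
open import Relation.Binary.PropositionalEquality using (_≡_; _≢_)
import Data.Nat as N

Weight : ℕ → Set
Weight n = Fin n → Fin n → ℕ

Symmetric : ∀ {n} → Weight n → Set
Symmetric w = ∀ x y → w x y ≡ w y x

Bounded : ∀ {n} → ℕ → Weight n → Set
Bounded ℓ w = ∀ x y → w x y ≤ ℓ

dist : ℕ → ℕ → ℕ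
dist a b = (a ∸ b) ⊔ (b ∸ a)

maxOver : ∀ {n} → (Fin n → Bool) → (Fin n → ℕ) → ℕ
maxOver {zero}  p c = 0
maxOver {suc n} p c =
  (if p F.zero then c F.zero else 0) ⊔ maxOver (λ i → p (F.suc i)) (λ i → c (F.suc i))

mem : ∀ {n} → Subset n → Fin n → Bool
mem Y v = lookup Y v

ProperIn : ∀ {n} → Weight n → ℕ → (Fin n → ℕ) → Set
ProperIn w s c =
  (∀ x → 1 ≤ c x × c x ≤ s) × (∀ x y → x ≢ y → w x y ≤ dist (c x) (c y))

IsSpan : ∀ {n} → Weight n → ℕ → Set
IsSpan w s =
  (∃ λ c → ProperIn w s c) × (∀ s' c → ProperIn w s' c → s ≤ s')

-- ---------- T[Y,g] ----------
-- an assignment c on Y (values off Y are irrelevant) belonging to A_{Y,g}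
InA : ∀ {n} → Weight n → Subset n → (Fin n → ℕ) → (Fin n → ℕ) → Set
InA w Y g c =
  (∀ x y → mem Y x ≡ true → mem Y y ≡ true → x ≢ y → w x y ≤ dist (c x) (c y))
  × (∀ y → mem Y y ≡ true → g y ≤ c y)

spanOn : ∀ {n} → Subset n → (Fin n → ℕ) → ℕ
spanOn Y c = maxOver (mem Y) c

-- IsT w Y g t  :  t = T[Y,g]  (minimum span of an assignment in A_{Y,g})
IsT : ∀ {n} → Weight n → Subset n → (Fin n → ℕ) → ℕ → Set
IsT w Y g t =
  (∃ λ c → InA w Y g c × spanOn Y c ≡ t) × (∀ c → InA w Y g c → t ≤ spanOn Y c)

LabelOn : ∀ {n} → ℕ → Subset n → (Fin n → ℕ) → Set
LabelOn ℓ X f = ∀ v → mem X v ≡ true → 1 ≤ f v × f v ≤ suc ℓ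

-- complement and f̄
-- f̄(v) = 1 + max({1 + w(u,v) − f(u) : uv ∈ E, u ∈ X} ∪ {0});
-- truncated subtraction ∸ is harmless because of the max with 0.
fbar : ∀ {n} → Weight n → Subset n → (Fin n → ℕ) → Fin n → ℕ
fbar w X f v = suc (maxOver (λ u → mem X u ∧ ⌊ 0 N.<? w u v ⌋) (λ u → suc (w u v) ∸ f u))

-- Let c be a proper colouring of optimal span s, X the n/2 vertices of smallest colour and M the
-- smallest colour outside X.  Counting colours downwards from M on X and upwards from M on X̄ gives
-- assignments in A_{X,f} and A_{X̄,f̄} (f being the first one clipped to ℓ+1) whose spans add up to
-- at most s + 1.  Conversely, any c₁ ∈ A_{X,f} and c₂ ∈ A_{X̄,f̄} of spans T₁ and T₂ glue into a proper
-- colouring of span T₁ + T₂ − 1: reverse c₁ into [1, T₁] on X and shift c₂ into [T₁, T₁ + T₂ − 1]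
-- on X̄; the definition of f̄ is exactly what separates the edges between X and X̄.
module Submission where

open import Defs
open import Data.Bool using (Bool; true; false; not; _∧_; if_then_else_)
open import Data.Bool.Properties using (not-injective)
open import Data.Fin using (Fin; zero; suc; toℕ; _≟_)
open import Data.Fin.Properties using (all?; toℕ<n; toℕ-injective)
open import Data.Fin.Subset using (Subset; ∁; ∣_∣; ⊥)
open import Data.Fin.Subset.Properties using (∣⊥∣≡0)
open import Data.Nat using (ℕ; zero; suc; _+_; _*_; _∸_; _≤_; _<_; _/_; _⊔_; _⊓_; z≤n; s≤s; _≤?_; _<?_; ∣_-_∣)
open import Data.Nat.DivMod using (/-monoˡ-≤; m/n<m)
open import Data.Nat.Divisibility using (_∣_)
open import Data.Nat.Induction using (<-rec)
open import Data.Nat.Properties hiding (_≟_)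
open import Algebra.Properties.CommutativeSemigroup +-commutativeSemigroup using (x∙yz≈y∙xz)
open import Data.Product using (Σ; ∃; _×_; _,_; proj₁; proj₂)
open import Data.Sum using (_⊎_; inj₁; inj₂)
open import Data.Vec using (Vec; []; _∷_; lookup; tabulate; _[_]≔_)
open import Data.Vec.Properties using (lookup-map; lookup-replicate; lookup∘tabulate; lookup∘updateAt; lookup∘updateAt′)
open import Data.Vec.Relation.Unary.All using (All; []; _∷_)
open import Data.Vec.Relation.Unary.All.Properties using (tabulate⁺)
open import Function using (_∘_; const)
open import Relation.Binary.PropositionalEquality
open import Relation.Nullary using (Dec; yes; no; ¬?; contradiction)
open import Relation.Nullary.Decidable using (⌊_⌋; map′; _×-dec_; _→-dec_; dec-true; isYes≗does)
open import Relation.Unary using (Pred; Decidable)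

dist-comm : ∀ a b → dist a b ≡ dist b a
dist-comm a b = ⊔-comm (a ∸ b) (b ∸ a)

dist≡∣-∣ : ∀ a b → dist a b ≡ ∣ a - b ∣
dist≡∣-∣ zero    zero    = refl
dist≡∣-∣ zero    (suc b) = refl
dist≡∣-∣ (suc a) zero    = ⊔-identityʳ (suc a)
dist≡∣-∣ (suc a) (suc b) = dist≡∣-∣ a b

≤-dist : ∀ {a b k} → a + k ≤ b → k ≤ dist a b
≤-dist {a} {b} {k} a+k≤b = ≤-trans (m+n≤o⇒m≤o∸n k (subst (_≤ b) (+-comm a k) a+k≤b)) (m≤n⊔m (a ∸ b) (b ∸ a))

dist-+ˡ : ∀ k a b → dist (k + a) (k + b) ≡ dist a b
dist-+ˡ k a b = cong₂ _⊔_ ([m+n]∸[m+o]≡n∸o k a b) ([m+n]∸[m+o]≡n∸o k b a)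

dist-∸ʳ : ∀ {M a b} → M ≤ a → M ≤ b → dist (a ∸ M) (b ∸ M) ≡ dist a b
dist-∸ʳ {M} {a} {b} M≤a M≤b = begin
  dist (a ∸ M) (b ∸ M)             ≡⟨ dist-+ˡ M (a ∸ M) (b ∸ M) ⟨
  dist (M + (a ∸ M)) (M + (b ∸ M)) ≡⟨ cong₂ dist (m+[n∸m]≡n M≤a) (m+[n∸m]≡n M≤b) ⟩
  dist a b                         ∎
  where open ≡-Reasoning

[o∸m]∸[o∸n]≡n∸m : ∀ o m n → n ≤ o → (o ∸ m) ∸ (o ∸ n) ≡ n ∸ m
[o∸m]∸[o∸n]≡n∸m o       zero    n       n≤o       = m∸[m∸n]≡n n≤o
[o∸m]∸[o∸n]≡n∸m o       (suc m) zero    _         = m≤n⇒m∸n≡0 (m∸n≤m o (suc m))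
[o∸m]∸[o∸n]≡n∸m (suc o) (suc m) (suc n) (s≤s n≤o) = [o∸m]∸[o∸n]≡n∸m o m n n≤o

dist-reflect : ∀ {K a b} → a ≤ K → b ≤ K → dist (K ∸ a) (K ∸ b) ≡ dist a b
dist-reflect {K} {a} {b} a≤K b≤K =
  trans (cong₂ _⊔_ ([o∸m]∸[o∸n]≡n∸m K a b b≤K) ([o∸m]∸[o∸n]≡n∸m K b a a≤K)) (dist-comm b a)

dist-split : ∀ {a M b} → a ≤ M → M ≤ b → dist a b ≡ (M ∸ a) + (b ∸ M)
dist-split {a} {M} {b} a≤M M≤b = begin
  dist a b        ≡⟨ cong (_⊔ (b ∸ a)) (m≤n⇒m∸n≡0 (≤-trans a≤M M≤b)) ⟩
  b ∸ a           ≡⟨ cong (_∸ a) (m∸n+n≡m M≤b) ⟨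
  b ∸ M + M ∸ a   ≡⟨ +-∸-assoc (b ∸ M) a≤M ⟩
  b ∸ M + (M ∸ a) ≡⟨ +-comm (b ∸ M) (M ∸ a) ⟩
  M ∸ a + (b ∸ M) ∎
  where open ≡-Reasoning

pred-+-cancelˡ-≤ : ∀ {o m n} → 1 ≤ o → o + m ∸ 1 ≤ o + n ∸ 1 → m ≤ n
pred-+-cancelˡ-≤ {suc o} _ = +-cancelˡ-≤ o _ _

pred-+-cancelʳ-≤ : ∀ {o m n} → 1 ≤ o → m + o ∸ 1 ≤ n + o ∸ 1 → m ≤ n
pred-+-cancelʳ-≤ {o} {m} {n} 1≤o le =
  pred-+-cancelˡ-≤ 1≤o (subst₂ (λ a b → a ∸ 1 ≤ b ∸ 1) (+-comm m o) (+-comm n o) le)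

≤-maxOver : ∀ {n} (p : Fin n → Bool) (c : Fin n → ℕ) {u} → p u ≡ true → c u ≤ maxOver p c
≤-maxOver p c {zero}  pu rewrite pu = m≤m⊔n (c zero) _
≤-maxOver p c {suc u} pu = ≤-trans (≤-maxOver (p ∘ suc) (c ∘ suc) pu) (m≤n⊔m _ _)

maxOver-lub : ∀ {n} (p : Fin n → Bool) (c : Fin n → ℕ) {B} → (∀ u → p u ≡ true → c u ≤ B) → maxOver p c ≤ B
maxOver-lub {zero}  p c h = z≤n
maxOver-lub {suc n} p c h = ⊔-lub head (maxOver-lub (p ∘ suc) (c ∘ suc) (h ∘ suc))
  where
  head : (if p zero then c zero else 0) ≤ _
  head with p zero in p0
  ... | true  = h zero p0
  ... | false = z≤n

∧-≡-trueˡ : ∀ {a b} → (a ∧ b) ≡ true → a ≡ true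
∧-≡-trueˡ {true}  _  = refl
∧-≡-trueˡ {false} ()

Inhabited : ∀ {n} → Subset n → Set
Inhabited X = ∃ λ x → mem X x ≡ true

spanOn-pos : ∀ {n} {Y : Subset n} {c : Fin n → ℕ} → Inhabited Y → (∀ y → mem Y y ≡ true → 1 ≤ c y) → 1 ≤ spanOn Y c
spanOn-pos {c = c} (y , y∈Y) c-pos = ≤-trans (c-pos y y∈Y) (≤-maxOver _ c y∈Y)

InA-pos : ∀ {n} {w : Weight n} {Y g c} → (∀ y → mem Y y ≡ true → 1 ≤ g y) → InA w Y g c → ∀ y → mem Y y ≡ true → 1 ≤ c y
InA-pos g-pos c∈A y y∈Y = ≤-trans (g-pos y y∈Y) (proj₂ c∈A y y∈Y)

∁⁺ : ∀ {n} (X : Subset n) {v} → mem X v ≡ false → mem (∁ X) v ≡ true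
∁⁺ X {v} v∉X = trans (lookup-map v not X) (cong not v∉X)

∁⁻ : ∀ {n} (X : Subset n) {v} → mem (∁ X) v ≡ true → mem X v ≡ false
∁⁻ X {v} v∈∁X = not-injective (trans (sym (lookup-map v not X)) v∈∁X)

inhabited : ∀ {n} (X : Subset n) → 0 < ∣ X ∣ → Inhabited X
inhabited (true  ∷ X) _ = zero , refl
inhabited (false ∷ X) h with inhabited X h
... | v , v∈X = suc v , v∈X

∁-inhabited : ∀ {n} (X : Subset n) → ∣ X ∣ < n → Inhabited (∁ X)
∁-inhabited (false ∷ X) _         = zero , refl
∁-inhabited (true  ∷ X) (s≤s lt) with ∁-inhabited X lt
... | v , v∈∁X = suc v , v∈∁X

∣[]≔true∣ : ∀ {n} (X : Subset n) {v} → mem X v ≡ false → ∣ X [ v ]≔ true ∣ ≡ suc ∣ X ∣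
∣[]≔true∣ (false ∷ X) {zero}  _   = refl
∣[]≔true∣ (true  ∷ X) {suc v} v∉X = cong suc (∣[]≔true∣ X v∉X)
∣[]≔true∣ (false ∷ X) {suc v} v∉X = ∣[]≔true∣ X v∉X

∈-[]≔true⁻ : ∀ {n} (X : Subset n) {u v} → mem (X [ v ]≔ true) u ≡ true → u ≡ v ⊎ mem X u ≡ true
∈-[]≔true⁻ X {u} {v} u∈ with u ≟ v
... | yes u≡v = inj₁ u≡v
... | no  u≢v = inj₂ (trans (sym (lookup∘updateAt′ u v u≢v X)) u∈)

∁-[]≔true⁻ : ∀ {n} (X : Subset n) {u v} → mem (∁ (X [ v ]≔ true)) u ≡ true → mem (∁ X) u ≡ true
∁-[]≔true⁻ X {u} {v} u∈∁ with u ≟ v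
... | yes refl = contradiction (trans (sym (lookup∘updateAt u {const true} X)) (∁⁻ (X [ u ]≔ true) u∈∁)) λ ()
... | no  u≢v  = ∁⁺ X (trans (sym (lookup∘updateAt′ u v u≢v X)) (∁⁻ (X [ v ]≔ true) u∈∁))

Minimiser : ∀ {n} → (Fin n → Bool) → (Fin n → ℕ) → Set
Minimiser p c = ∃ λ v → p v ≡ true × (∀ u → p u ≡ true → c v ≤ c u)

minimiser⊎none : ∀ {n} (p : Fin n → Bool) (c : Fin n → ℕ) → Minimiser p c ⊎ (∀ u → p u ≡ false)
minimiser⊎none {zero}  p c = inj₂ λ ()
minimiser⊎none {suc n} p c with minimiser⊎none (p ∘ suc) (c ∘ suc) | p zero in p0
... | inj₂ none | false = inj₂ λ { zero → p0 ; (suc u) → none u }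
... | inj₂ none | true  = inj₁ (zero , p0 , λ
  { zero _ → ≤-refl ; (suc u) pu → contradiction (trans (sym pu) (none u)) λ () })
... | inj₁ (v , pv , v-min) | false = inj₁ (suc v , pv , λ
  { zero pu → contradiction (trans (sym pu) p0) λ () ; (suc u) pu → v-min u pu })
... | inj₁ (v , pv , v-min) | true with c zero ≤? c (suc v)
...   | yes c0≤ = inj₁ (zero , p0 , λ { zero _ → ≤-refl ; (suc u) pu → ≤-trans c0≤ (v-min u pu) })
...   | no  c0≰ = inj₁ (suc v , pv , λ { zero _ → <⇒≤ (≰⇒> c0≰) ; (suc u) pu → v-min u pu })

minimiser : ∀ {n} (p : Fin n → Bool) (c : Fin n → ℕ) → (∃ λ u → p u ≡ true) → Minimiser p c
minimiser p c (u , pu) with minimiser⊎none p c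
... | inj₁ m    = m
... | inj₂ none = contradiction (trans (sym pu) (none u)) λ ()

LowerPart : ∀ {n} → (Fin n → ℕ) → Subset n → Set
LowerPart c X = ∀ u v → mem X u ≡ true → mem (∁ X) v ≡ true → c u ≤ c v

lowerPart-of-size : ∀ {n} (c : Fin n → ℕ) k → k ≤ n → ∃ λ X → ∣ X ∣ ≡ k × LowerPart c X
lowerPart-of-size {n} c zero _ =
  ⊥ , ∣⊥∣≡0 n , λ u _ u∈⊥ _ → contradiction (trans (sym u∈⊥) (lookup-replicate u false)) λ ()
lowerPart-of-size c (suc k) k<n with lowerPart-of-size c k (<⇒≤ k<n)
... | X , ∣X∣≡k , X-lower with minimiser (mem (∁ X)) c (∁-inhabited X (subst (_< _) (sym ∣X∣≡k) k<n))
... | v , v∈∁X , v-min = X [ v ]≔ true , trans (∣[]≔true∣ X (∁⁻ X v∈∁X)) (cong suc ∣X∣≡k) , lower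
  where
  lower : LowerPart c (X [ v ]≔ true)
  lower u y u∈ y∈∁ with ∈-[]≔true⁻ X u∈
  ... | inj₁ refl = v-min y (∁-[]≔true⁻ X y∈∁)
  ... | inj₂ u∈X  = X-lower u y u∈X (∁-[]≔true⁻ X y∈∁)

anyBoundedVec? : ∀ {n p} {P : Pred (Vec ℕ n) p} → Decidable P → ∀ B → Dec (∃ λ v → All (_< B) v × P v)
anyBoundedVec? {zero}  P? B = map′ (λ p → [] , [] , p) (λ { ([] , [] , p) → p }) (P? [])
anyBoundedVec? {suc n} P? B = map′
  (λ { (a , a<B , v , v<B , p) → a ∷ v , a<B ∷ v<B , p })
  (λ { (a ∷ v , a<B ∷ v<B , p) → a , a<B , v , v<B , p })
  (anyUpTo? (λ a → anyBoundedVec? (λ v → P? (a ∷ v)) B) B)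

Least : ∀ {p} → Pred ℕ p → ℕ → Set p
Least P t = P t × (∀ t' → P t' → t ≤ t')

least-witness : ∀ {p} {P : Pred ℕ p} → Decidable P → ∀ B → P B → ∃ (Least P)
least-witness {P = P} P? = <-rec (λ B → P B → ∃ (Least P)) step
  where
  step : ∀ B → (∀ {t} → t < B → P t → ∃ (Least P)) → P B → ∃ (Least P)
  step B rec PB with anyUpTo? P? B
  ... | yes (t , t<B , Pt) = rec t<B Pt
  ... | no  none           = B , PB , λ t' Pt' → ≮⇒≥ λ t'<B → none (t' , t'<B , Pt')

proper? : ∀ {n} (w : Weight n) s (c : Fin n → ℕ) → Dec (ProperIn w s c)
proper? w s c =
  all? (λ x → (1 ≤? c x) ×-dec (c x ≤? s)) ×-dec
  all? (λ x → all? λ y → ¬? (x ≟ y) →-dec (w x y ≤? dist (c x) (c y)))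

proper-resp-≗ : ∀ {n} {w : Weight n} {s c d} → c ≗ d → ProperIn w s c → ProperIn w s d
proper-resp-≗ {w = w} {s} c≗d (c-bounds , c-separates) =
  (λ x → subst (λ a → 1 ≤ a × a ≤ s) (c≗d x) (c-bounds x)) ,
  λ x y x≢y → subst₂ (λ a b → w x y ≤ dist a b) (c≗d x) (c≗d y) (c-separates x y x≢y)

Colourable : ∀ {n} → Weight n → ℕ → Set
Colourable w s = ∃ (ProperIn w s)

colourable? : ∀ {n} (w : Weight n) → Decidable (Colourable w)
colourable? w s = map′
  (λ { (v , _ , v-proper) → lookup v , v-proper })
  (λ { (c , c-proper) → tabulate c , tabulate⁺ (λ x → s≤s (proj₂ (proj₁ c-proper x))) ,
                        proper-resp-≗ (λ x → sym (lookup∘tabulate c x)) c-proper })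
  (anyBoundedVec? (proper? w s ∘ lookup) (suc s))

spread-proper : ∀ {n ℓ} {w : Weight n} → Bounded ℓ w → ProperIn w (suc (ℓ * n)) (λ x → suc (ℓ * toℕ x))
spread-proper {n} {ℓ} {w} w-bounded = (λ x → s≤s z≤n , s≤s (*-monoʳ-≤ ℓ (<⇒≤ (toℕ<n x)))) , separates
  where
  separates : ∀ x y → x ≢ y → w x y ≤ dist (suc (ℓ * toℕ x)) (suc (ℓ * toℕ y))
  separates x y x≢y = begin
    w x y                        ≤⟨ w-bounded x y ⟩
    ℓ                            ≡⟨ *-identityʳ ℓ ⟨
    ℓ * 1                        ≤⟨ *-monoʳ-≤ ℓ (n≢0⇒n>0 (x≢y ∘ toℕ-injective ∘ ∣m-n∣≡0⇒m≡n)) ⟩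
    ℓ * ∣ toℕ x - toℕ y ∣        ≡⟨ *-distribˡ-∣-∣ ℓ (toℕ x) (toℕ y) ⟩
    ∣ ℓ * toℕ x - ℓ * toℕ y ∣    ≡⟨ dist≡∣-∣ (ℓ * toℕ x) (ℓ * toℕ y) ⟨
    dist (ℓ * toℕ x) (ℓ * toℕ y) ∎
    where open ≤-Reasoning

span-exists : ∀ {n ℓ} {w : Weight n} → Bounded ℓ w → ∃ (IsSpan w)
span-exists {w = w} w-bounded with least-witness (colourable? w) _ (_ , spread-proper w-bounded)
... | s , s-colourable , s-least = s , s-colourable , λ s' c c-proper → s-least s' (c , c-proper)

fbar-edge : ∀ {n} {w : Weight n} {X f u v} → mem X u ≡ true → 0 < w u v → 2 + w u v ≤ f u + fbar w X f v
fbar-edge {w = w} {X} {f} {u} {v} u∈X w>0 = begin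
  2 + w u v                       ≤⟨ s≤s (m≤n+m∸n (suc (w u v)) (f u)) ⟩
  suc (f u + (suc (w u v) ∸ f u)) ≡⟨ +-suc (f u) _ ⟨
  f u + suc (suc (w u v) ∸ f u)   ≤⟨ +-monoʳ-≤ (f u) (s≤s (≤-maxOver adjacent (λ u → suc (w u v) ∸ f u) u-adjacent)) ⟩
  f u + fbar w X f v              ∎
  where
  open ≤-Reasoning
  adjacent : Fin _ → Bool
  adjacent x = mem X x ∧ ⌊ 0 <? w x v ⌋
  u-adjacent : adjacent u ≡ true
  u-adjacent = trans (cong (_∧ ⌊ 0 <? w u v ⌋) u∈X) (trans (isYes≗does (0 <? w u v)) (dec-true (0 <? w u v) w>0))

gap-dist : ∀ {S a b k} → a ≤ suc S → 2 + k ≤ a + b → k ≤ dist (2 + S ∸ a) (S + b)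
gap-dist {S} {a} {b} {k} a≤1+S 2+k≤a+b = ≤-dist (+-cancelˡ-≤ a _ _ (begin
  a + (2 + S ∸ a + k) ≡⟨ +-assoc a (2 + S ∸ a) k ⟨
  a + (2 + S ∸ a) + k ≡⟨ cong (_+ k) (m+[n∸m]≡n (m≤n⇒m≤1+n a≤1+S)) ⟩
  2 + S + k           ≡⟨ x∙yz≈y∙xz 2 S k ⟩
  S + (2 + k)         ≤⟨ +-monoʳ-≤ S 2+k≤a+b ⟩
  S + (a + b)         ≡⟨ x∙yz≈y∙xz S a b ⟩
  a + (S + b)         ∎))
  where open ≤-Reasoning

reflect-bounds : ∀ {S T a} → 1 ≤ a → a ≤ suc S → 1 ≤ T → 1 ≤ 2 + S ∸ a × 2 + S ∸ a ≤ S + T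
reflect-bounds {S} {T} {suc a} _ (s≤s a≤S) 1≤T = m<n⇒0<n∸m (s≤s a≤S) , (begin
  suc S ∸ a ≤⟨ m∸n≤m (suc S) a ⟩
  suc S     ≡⟨ +-comm 1 S ⟩
  S + 1     ≤⟨ +-monoʳ-≤ S 1≤T ⟩
  S + T     ∎)
  where open ≤-Reasoning

module Merge {n ℓ} {w : Weight n} (w-sym : Symmetric w) (X : Subset n) {f : Fin n → ℕ} (f-label : LabelOn ℓ X f)
             {c₁ c₂ : Fin n → ℕ} (c₁∈A : InA w X f c₁) (c₂∈A : InA w (∁ X) (fbar w X f) c₂) where

  c₁-pos : ∀ x → mem X x ≡ true → 1 ≤ c₁ x
  c₁-pos = InA-pos {Y = X} {g = f} (λ x x∈X → proj₁ (f-label x x∈X)) c₁∈A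

  c₂-pos : ∀ y → mem (∁ X) y ≡ true → 1 ≤ c₂ y
  c₂-pos = InA-pos {Y = ∁ X} {g = fbar w X f} (λ _ _ → s≤s z≤n) c₂∈A

  -- With S = T₁ − 1, X is coloured by c₁ reversed into [1, T₁] and X̄ by c₂ shifted into [T₁, S + T₂].
  merged : ℕ → Fin n → ℕ
  merged S v = if mem X v then 2 + S ∸ c₁ v else S + c₂ v

  merged-proper : ∀ {S} → spanOn X c₁ ≡ suc S → 1 ≤ spanOn (∁ X) c₂ → ProperIn w (S + spanOn (∁ X) c₂) (merged S)
  merged-proper {S} T₁≡1+S 1≤T₂ = bounds , separates
    where
    c₁≤ : ∀ x → mem X x ≡ true → c₁ x ≤ suc S
    c₁≤ x x∈X = subst (c₁ x ≤_) T₁≡1+S (≤-maxOver (mem X) c₁ x∈X)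

    bounds : ∀ v → 1 ≤ merged S v × merged S v ≤ S + spanOn (∁ X) c₂
    bounds v with mem X v in v∈X
    ... | true  = reflect-bounds (c₁-pos v v∈X) (c₁≤ v v∈X) 1≤T₂
    ... | false = ≤-trans (c₂-pos v (∁⁺ X v∈X)) (m≤n+m (c₂ v) S) ,
                  +-monoʳ-≤ S (≤-maxOver (mem (∁ X)) c₂ (∁⁺ X v∈X))

    across : ∀ x y → mem X x ≡ true → mem X y ≡ false → w x y ≤ dist (2 + S ∸ c₁ x) (S + c₂ y)
    across x y x∈X y∉X with 0 <? w x y
    ... | no  w≯0 = ≤-trans (≮⇒≥ w≯0) z≤n
    ... | yes w>0 = gap-dist (c₁≤ x x∈X)
      (≤-trans (fbar-edge {w = w} {X} {f} x∈X w>0) (+-mono-≤ (proj₂ c₁∈A x x∈X) (proj₂ c₂∈A y (∁⁺ X y∉X))))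

    separates : ∀ x y → x ≢ y → w x y ≤ dist (merged S x) (merged S y)
    separates x y x≢y with mem X x in x∈X | mem X y in y∈X
    ... | true  | true  = subst (w x y ≤_) (sym (dist-reflect {2 + S} (m≤n⇒m≤1+n (c₁≤ x x∈X)) (m≤n⇒m≤1+n (c₁≤ y y∈X))))
                            (proj₁ c₁∈A x y x∈X y∈X x≢y)
    ... | false | false = subst (w x y ≤_) (sym (dist-+ˡ S (c₂ x) (c₂ y)))
                            (proj₁ c₂∈A x y (∁⁺ X x∈X) (∁⁺ X y∈X) x≢y)
    ... | true  | false = across x y x∈X y∈X
    ... | false | true  = subst₂ _≤_ (w-sym y x) (dist-comm (2 + S ∸ c₁ y) (S + c₂ x)) (across y x y∈X x∈X)

  merge-proper : Inhabited X × Inhabited (∁ X) → Colourable w (spanOn X c₁ + spanOn (∁ X) c₂ ∸ 1)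
  merge-proper X-halves with spanOn X c₁ in T₁≡ | spanOn-pos {Y = X} (proj₁ X-halves) c₁-pos
  ... | zero  | ()
  ... | suc S | _ = merged S , merged-proper T₁≡ (spanOn-pos {Y = ∁ X} (proj₂ X-halves) c₂-pos)

module Split {n ℓ} {w : Weight n} (w-bounded : Bounded ℓ w) {s} {c : Fin n → ℕ} (c-proper : ProperIn w s c)
             (X : Subset n) (X-lower : LowerPart c X) {m : Fin n} (m∈∁X : mem (∁ X) m ≡ true)
             (m-min : ∀ y → mem (∁ X) y ≡ true → c m ≤ c y) where

  M : ℕ
  M = c m

  below above label : Fin n → ℕ
  below x = suc (M ∸ c x)
  above y = suc (c y ∸ M)
  label x = below x ⊓ suc ℓ

  label-on : LabelOn ℓ X label
  label-on _ _ = ⊓-glb (s≤s z≤n) (s≤s z≤n) , m⊓n≤n _ _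

  X≤M : ∀ x → mem X x ≡ true → c x ≤ M
  X≤M x x∈X = X-lower x m x∈X m∈∁X

  below∈A : InA w X label below
  below∈A =
    (λ x y x∈X y∈X x≢y → subst (w x y ≤_) (sym (dist-reflect (X≤M x x∈X) (X≤M y y∈X))) (proj₂ c-proper x y x≢y)) ,
    λ _ _ → m⊓n≤m _ _

  adjacent-gap : ∀ u y → (mem X u ∧ ⌊ 0 <? w u y ⌋) ≡ true → mem (∁ X) y ≡ true → suc (w u y) ∸ label u ≤ c y ∸ M
  adjacent-gap u y adjacent y∈∁X = begin
    suc (w u y) ∸ (below u ⊓ suc ℓ)   ≡⟨ ∸-distribˡ-⊓-⊔ (suc (w u y)) (below u) (suc ℓ) ⟩
    (w u y ∸ (M ∸ c u)) ⊔ (w u y ∸ ℓ) ≡⟨ cong ((w u y ∸ (M ∸ c u)) ⊔_) (m≤n⇒m∸n≡0 (w-bounded u y)) ⟩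
    (w u y ∸ (M ∸ c u)) ⊔ 0           ≡⟨ ⊔-identityʳ _ ⟩
    w u y ∸ (M ∸ c u)                 ≤⟨ m≤n+o⇒m∸n≤o (w u y) (M ∸ c u) w≤gap ⟩
    c y ∸ M                           ∎
    where
    open ≤-Reasoning
    u∈X : mem X u ≡ true
    u∈X = ∧-≡-trueˡ adjacent
    u≢y : u ≢ y
    u≢y refl = contradiction (trans (sym u∈X) (∁⁻ X y∈∁X)) λ ()
    w≤gap : w u y ≤ (M ∸ c u) + (c y ∸ M)
    w≤gap = subst (w u y ≤_) (dist-split (X≤M u u∈X) (m-min y y∈∁X)) (proj₂ c-proper u y u≢y)

  above∈A : InA w (∁ X) (fbar w X label) above
  above∈A =
    (λ x y x∈∁X y∈∁X x≢y → subst (w x y ≤_) (sym (dist-∸ʳ (m-min x x∈∁X) (m-min y y∈∁X))) (proj₂ c-proper x y x≢y)) ,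
    λ y y∈∁X → s≤s (maxOver-lub _ _ λ u adjacent → adjacent-gap u y adjacent y∈∁X)

  span-bound : spanOn X below + spanOn (∁ X) above ∸ 1 ≤ s
  span-bound = begin
    spanOn X below + spanOn (∁ X) above ∸ 1 ≤⟨ ∸-monoˡ-≤ 1 (+-mono-≤ below≤M above≤) ⟩
    M + suc (s ∸ M) ∸ 1                     ≡⟨ cong (_∸ 1) (+-suc M (s ∸ M)) ⟩
    M + (s ∸ M)                             ≡⟨ m+[n∸m]≡n (proj₂ (proj₁ c-proper m)) ⟩
    s                                       ∎
    where
    open ≤-Reasoning
    below≤M : spanOn X below ≤ M
    below≤M = maxOver-lub _ _ λ x x∈X → ∸-monoʳ-< (proj₁ (proj₁ c-proper x)) (X≤M x x∈X)
    above≤ : spanOn (∁ X) above ≤ suc (s ∸ M)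
    above≤ = maxOver-lub _ _ λ y _ → s≤s (∸-monoˡ-≤ M (proj₂ (proj₁ c-proper y)))

split : ∀ {n ℓ} {w : Weight n} → Bounded ℓ w → ∀ {s c} → ProperIn w s c → ∀ k → k < n →
  ∃ λ X → ∃ λ f → ∃ λ c₁ → ∃ λ c₂ →
    ∣ X ∣ ≡ k × LabelOn ℓ X f × InA w X f c₁ × InA w (∁ X) (fbar w X f) c₂ × spanOn X c₁ + spanOn (∁ X) c₂ ∸ 1 ≤ s
split w-bounded {c = c} c-proper k k<n with lowerPart-of-size c k (<⇒≤ k<n)
... | X , ∣X∣≡k , X-lower with minimiser (mem (∁ X)) c (∁-inhabited X (subst (_< _) (sym ∣X∣≡k) k<n))
... | m , m∈∁X , m-min = X , label , below , above , ∣X∣≡k , label-on , below∈A , above∈A , span-bound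
  where open Split w-bounded c-proper X X-lower m∈∁X m-min

module Optimality {n ℓ} {w : Weight n} (w-sym : Symmetric w) {s} (s-span : IsSpan w s) (X : Subset n) {f : Fin n → ℕ}
                  (f-label : LabelOn ℓ X f) (X-halves : Inhabited X × Inhabited (∁ X)) where

  span≤merge : ∀ {c₁ c₂} → InA w X f c₁ → InA w (∁ X) (fbar w X f) c₂ → s ≤ spanOn X c₁ + spanOn (∁ X) c₂ ∸ 1
  span≤merge c₁∈A c₂∈A with Merge.merge-proper w-sym X f-label c₁∈A c₂∈A X-halves
  ... | d , d-proper = proj₂ s-span _ d d-proper

  halves-optimal : ∀ {c₁ c₂} → InA w X f c₁ → InA w (∁ X) (fbar w X f) c₂ → spanOn X c₁ + spanOn (∁ X) c₂ ∸ 1 ≤ s →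
    IsT w X f (spanOn X c₁) × IsT w (∁ X) (fbar w X f) (spanOn (∁ X) c₂)
  halves-optimal {c₁} {c₂} c₁∈A c₂∈A merge≤s =
    ((c₁ , c₁∈A , refl) , λ c₁′ c₁′∈A → pred-+-cancelʳ-≤ T₂-pos (≤-trans merge≤s (span≤merge c₁′∈A c₂∈A))) ,
    ((c₂ , c₂∈A , refl) , λ c₂′ c₂′∈A → pred-+-cancelˡ-≤ T₁-pos (≤-trans merge≤s (span≤merge c₁∈A c₂′∈A)))
    where
    open Merge w-sym X f-label c₁∈A c₂∈A using (c₁-pos; c₂-pos)
    T₁-pos : 1 ≤ spanOn X c₁
    T₁-pos = spanOn-pos {Y = X} (proj₁ X-halves) c₁-pos
    T₂-pos : 1 ≤ spanOn (∁ X) c₂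
    T₂-pos = spanOn-pos {Y = ∁ X} (proj₂ X-halves) c₂-pos

span≤T-sum : ∀ {n ℓ} {w : Weight n} → Symmetric w → ∀ {s} → IsSpan w s → (X : Subset n) → ∀ {f t₁ t₂} →
  LabelOn ℓ X f → Inhabited X × Inhabited (∁ X) → IsT w X f t₁ → IsT w (∁ X) (fbar w X f) t₂ → s ≤ t₁ + t₂ ∸ 1
span≤T-sum w-sym s-span X f-label X-halves ((c₁ , c₁∈A , refl) , _) ((c₂ , c₂∈A , refl) , _) =
  Optimality.span≤merge w-sym s-span X f-label X-halves c₁∈A c₂∈A

n/2<n : ∀ {n} → 2 ≤ n → n / 2 < n
n/2<n {suc n} _ = m/n<m (suc n) 2 (s≤s (s≤s z≤n))

halves-inhabited : ∀ {n} (X : Subset n) → 2 ≤ n → ∣ X ∣ ≡ n / 2 → Inhabited X × Inhabited (∁ X)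
halves-inhabited X 2≤n ∣X∣≡n/2 =
  inhabited X (subst (0 <_) (sym ∣X∣≡n/2) (/-monoˡ-≤ 2 2≤n)) ,
  ∁-inhabited X (subst (_< _) (sym ∣X∣≡n/2) (n/2<n 2≤n))

lemma2 : (n ℓ : ℕ) → 2 ≤ n → 2 ∣ n → (w : Weight n) → Symmetric w → Bounded ℓ w →
    Σ ℕ λ s → IsSpan w s
      × (∃ λ X → ∃ λ f → ∃ λ t₁ → ∃ λ t₂ →
           ∣ X ∣ ≡ n / 2 × LabelOn ℓ X f × IsT w X f t₁ × IsT w (∁ X) (fbar w X f) t₂
           × s ≡ t₁ + t₂ ∸ 1)
      × (∀ (X : Subset n) f t₁ t₂ → ∣ X ∣ ≡ n / 2 → LabelOn ℓ X f →
           IsT w X f t₁ → IsT w (∁ X) (fbar w X f) t₂ → s ≤ t₁ + t₂ ∸ 1)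
lemma2 n ℓ 2≤n _ w w-sym w-bounded with span-exists w-bounded
... | s , s-span with split w-bounded (proj₂ (proj₁ s-span)) (n / 2) (n/2<n 2≤n)
... | X , f , c₁ , c₂ , ∣X∣≡n/2 , f-label , c₁∈A , c₂∈A , merge≤s =
  s , s-span ,
  (X , f , _ , _ , ∣X∣≡n/2 , f-label , proj₁ c-halves-optimal , proj₂ c-halves-optimal ,
   ≤-antisym (span≤merge c₁∈A c₂∈A) merge≤s) ,
  λ Y g _ _ ∣Y∣≡n/2 g-label → span≤T-sum w-sym s-span Y g-label (halves-inhabited Y 2≤n ∣Y∣≡n/2)
  where
  open Optimality w-sym s-span X f-label (halves-inhabited X 2≤n ∣X∣≡n/2)
  c-halves-optimal : IsT w X f (spanOn X c₁) × IsT w (∁ X) (fbar w X f) (spanOn (∁ X) c₂)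
  c-halves-optimal = halves-optimal c₁∈A c₂∈A merge≤s
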